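{- Let $s$ be a string and $c$ a character. Let $t=\mathit{sufpal}(sc,|sc|)$ and let $t'$ be the longest proper palindromic suffix of $t$ (possibly empty). Then for $1\le i\le|sc|$, \[ \mathit{presurf}(sc,i)=\begin{cases} t, & i=|sc|-|t|+1,\\ \epsilon, & i=|sc| \text{ and } |t|\ne 1,\\ \mathit{presurf}(s,i), & \text{otherwise},\end{cases} \] and \[ \mathit{sufsurf}(sc,i)=\begin{cases} t, & i=|sc|,\\ \epsilon, & i=|sc|-|t|+|t'| \text{ and } \mathit{sufsurf}(s,|sc|-|t|+|t'|)=t' \text{ and } |t'|\ge 1,\\ \mathit{sufsurf}(s,i), & \text{otherwise}.\end{cases} \]
   Context: $s[i..j]=s[i]\cdots s[j]$; $\epsilon$ is the empty string; a palindrome is a string equal to its reverse. For $1\le i\le|s|$: $\mathit{prelen}(s,i)$ is the length of the longest (non-empty) palindromic prefix $\mathit{prepal}(s,i)$ of $s[i..|s|]$, and $\mathit{suflen}(s,i)$ is the length of the longest palindromic suffix $\mathit{sufpal}(s,i)$ of $s[1..i]$. A non-empty palindromic substring $s[i..j]$ is a surface in $s$ if neither $s[i..r]$ nor $s[l..j]$ is a palindrome for any $1\le l<i\le j<r\le|s|$. Define $\mathit{presurf}(s,i)=\mathit{prepal}(s,i)$ if $s[i..i+\mathit{prelen}(s,i)-1]$ is a surface in $s$, and $\epsilon$ otherwise; $\mathit{sufsurf}(s,i)=\mathit{sufpal}(s,i)$ if $s[i-\mathit{suflen}(s,i)+1..i]$ is a surface in $s$, and $\epsilon$ otherwise. -}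

module Defs where

open import Data.Nat using (ℕ; zero; suc; _+_; _∸_; _≤_; _<_; _≤?_; _<?_; z≤n; s≤s)
open import Data.Nat.Properties using (m≤n⇒m<n∨m≡n; ≤-refl; m≤n⇒m≤1+n; <-≤-trans; ≤-pred)
open import Data.List using (List; []; _∷_; length; take; drop; reverse)
open import Data.List.Properties using (≡-dec)
open import Data.Product using (_×_; _,_)
open import Data.Sum using (inj₁; inj₂)
open import Data.Empty using (⊥-elim)
open import Relation.Nullary using (Dec; yes; no; ¬_)
open import Relation.Nullary.Decidable using (_×-dec_; ¬?)
open import Relation.Binary.Definitions using (DecidableEquality)
open import Relation.Binary.PropositionalEquality using (_≡_; refl)

-- Strings over an arbitrary alphabet A (with decidable equality) are lists;
-- positions are 1-based as in the paper.

module Strings {A : Set} (_≟_ : DecidableEquality A) where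

  String : Set
  String = List A

  -- s[i..j] = s[i] ⋯ s[j]   (for 1 ≤ i; empty when j < i)
  sub : String → ℕ → ℕ → String
  sub s i j = take (suc j ∸ i) (drop (i ∸ 1) s)

  IsPal : String → Set
  IsPal w = reverse w ≡ w

  isPal? : (w : String) → Dec (IsPal w)
  isPal? w = ≡-dec _≟_ (reverse w) w

  palPrefSearch : String → ℕ → ℕ
  palPrefSearch u zero = zero
  palPrefSearch u (suc k) with isPal? (take (suc k) u)
  ... | yes _ = suc k
  ... | no _  = palPrefSearch u k

  palSufSearch : String → ℕ → ℕ
  palSufSearch w zero = zero
  palSufSearch w (suc k) with isPal? (drop (length w ∸ suc k) w)
  ... | yes _ = suc k
  ... | no _  = palSufSearch w k

  prelen : String → ℕ → ℕ
  prelen s i = palPrefSearch (drop (i ∸ 1) s) (length (drop (i ∸ 1) s))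

  prepal : String → ℕ → String
  prepal s i = take (prelen s i) (drop (i ∸ 1) s)

  suflen : String → ℕ → ℕ
  suflen s i = palSufSearch (take i s) (length (take i s))

  sufpal : String → ℕ → String
  sufpal s i = drop (length (take i s) ∸ suflen s i) (take i s)

  longestProperPalSuffix : String → String
  longestProperPalSuffix t = drop (length t ∸ palSufSearch t (length t ∸ 1)) t

  Surface : String → ℕ → ℕ → Set
  Surface s i j =
    (1 ≤ i) × (i ≤ j) × (j ≤ length s) × IsPal (sub s i j)
    × (∀ r → j < r → r ≤ length s → ¬ IsPal (sub s i r))
    × (∀ l → 1 ≤ l → l < i → ¬ IsPal (sub s l j))

  allIn? : {P : ℕ → Set} → (∀ n → Dec (P n)) → ∀ a b → Dec (∀ r → a < r → r ≤ b → P r)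
  allIn? d a zero = yes λ { zero () _ ; (suc r) _ () }
  allIn? {P} d a (suc b) with a <? suc b
  ... | no a≮ = yes λ r x y → ⊥-elim (a≮ (<-≤-trans x y))
  ... | yes a< with d (suc b) | allIn? d a b
  ...   | no ¬p | _ = no λ f → ¬p (f (suc b) a< ≤-refl)
  ...   | yes p | no ¬f = no λ f → ¬f (λ r x y → f r x (m≤n⇒m≤1+n y))
  ...   | yes p | yes f = yes g
    where
    g : ∀ r → a < r → r ≤ suc b → P r
    g r x y with m≤n⇒m<n∨m≡n y
    ... | inj₁ r<sb = f r x (≤-pred r<sb)
    ... | inj₂ refl = p

  allLt? : {P : ℕ → Set} → (∀ n → Dec (P n)) → ∀ a b → Dec (∀ r → a < r → r < b → P r)
  allLt? d a zero = yes λ r _ ()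
  allLt? d a (suc b) with allIn? d a b
  ... | yes f = yes λ r x y → f r x (≤-pred y)
  ... | no ¬f = no λ f → ¬f (λ r x y → f r x (s≤s y))

  surface? : ∀ s i j → Dec (Surface s i j)
  surface? s i j =
    (1 ≤? i) ×-dec (i ≤? j) ×-dec (j ≤? length s) ×-dec isPal? (sub s i j)
    ×-dec allIn? (λ r → ¬? (isPal? (sub s i r))) j (length s)
    ×-dec allLt? (λ l → ¬? (isPal? (sub s l j))) 0 i

  presurf : String → ℕ → String
  presurf s i with surface? s i (i + prelen s i ∸ 1)
  ... | yes _ = prepal s i
  ... | no _  = []

  sufsurf : String → ℕ → String
  sufsurf s i with surface? s (suc i ∸ suflen s i) i
  ... | yes _ = sufpal s i
  ... | no _  = []

{-# OPTIONS --safe #-}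
-- Write S = s c, let t = S[P+1..N] be its longest palindromic suffix and t′ that of t.  A palindrome of S
-- not reaching position N is one of s, so surfaces of S and of s can only differ where some palindrome
-- S[b..N] exists, and then b ≥ P + 1.  For b > P + 1 the palindromes t and S[b..N] give t the period
-- b − P − 1, which lets every palindrome S[b..j] of s be extended to a palindrome S[l..j], P < l < b, so
-- S[b..j] is a surface of neither string.  For b = P + 1 reflecting in t exchanges a surface of s with
-- a proper palindromic suffix of t; maximality on both sides forces it to be the reflection of t′, which
-- lies at q = P + |t′| and equals t′.
module Submission where

open import Data.Nat using (ℕ; zero; suc; _+_; _*_; _∸_; _≤_; _<_; _<?_; z≤n; s≤s)
open import Data.Nat.Properties renaming (_≟_ to _≟ℕ_)
open import Data.Nat.Tactic.RingSolver using (solve-∀)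
open import Data.Nat.DivMod using (_%_; _/_; m≡m%n+[m/n]*n; m%n<n)
open import Data.List using (List; []; _∷_; length; take; drop; reverse; _++_; [_])
open import Data.List.Properties
  using (length-reverse; unfold-reverse; reverse-++; length-++; length-drop; length-take;
         take-all; drop-all; take-drop; drop-drop; take++drop≡id)
open import Data.Maybe using (Maybe; just; nothing)
open import Data.Product using (_×_; _,_; ∃; proj₁; proj₂)
open import Data.Sum using (_⊎_; inj₁; inj₂; [_,_]′)
open import Data.Empty using (⊥; ⊥-elim)
open import Function.Base using (_∘_)
open import Function.Bundles using (_⇔_; mk⇔; Equivalence)
open import Relation.Nullary using (¬_; Dec; yes; no)
import Relation.Nullary.Decidable as Dec
open import Relation.Nullary.Decidable using (toSum; decidable-stable)
open import Relation.Binary.PropositionalEquality hiding ([_])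
open import Relation.Binary.Definitions using (DecidableEquality)
open import Defs

m+n≡o⇒m≤o : ∀ {m o} n → m + n ≡ o → m ≤ o
m+n≡o⇒m≤o {m} n eq = subst (m ≤_) eq (m≤m+n m n)

≤⇒∃+ : ∀ {m n} → m ≤ n → ∃ λ d → n ≡ m + d
≤⇒∃+ {m} {n} m≤n = n ∸ m , sym (m+[n∸m]≡n m≤n)

module _ {A : Set} where

  index : List A → ℕ → Maybe A
  index []       _       = nothing
  index (x ∷ xs) zero    = just x
  index (x ∷ xs) (suc k) = index xs k

  -- s[i] of the paper: positions are 1-based and out-of-range positions (including 0) give nothing
  letter : List A → ℕ → Maybe A
  letter xs zero    = nothing
  letter xs (suc k) = index xs k

  index-ext : ∀ (xs ys : List A) → (∀ k → index xs k ≡ index ys k) → xs ≡ ys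
  index-ext []       []       _  = refl
  index-ext []       (y ∷ ys) eq with eq 0
  ... | ()
  index-ext (x ∷ xs) []       eq with eq 0
  ... | ()
  index-ext (x ∷ xs) (y ∷ ys) eq with eq 0
  ... | refl = cong (x ∷_) (index-ext xs ys (λ k → eq (suc k)))

  index-≥length : ∀ xs k → length xs ≤ k → index xs k ≡ nothing
  index-≥length []       k       _         = refl
  index-≥length (x ∷ xs) (suc k) (s≤s len≤k) = index-≥length xs k len≤k

  index-take : ∀ n xs k → k < n → index (take n xs) k ≡ index xs k
  index-take (suc n) []       k       _         = refl
  index-take (suc n) (x ∷ xs) zero    _         = refl
  index-take (suc n) (x ∷ xs) (suc k) (s≤s k<n) = index-take n xs k k<n

  index-drop : ∀ n xs k → index (drop n xs) k ≡ index xs (n + k)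
  index-drop zero    xs       k = refl
  index-drop (suc n) []       k = refl
  index-drop (suc n) (x ∷ xs) k = index-drop n xs k

  index-++ˡ : ∀ xs ys k → k < length xs → index (xs ++ ys) k ≡ index xs k
  index-++ˡ (x ∷ xs) ys zero    _         = refl
  index-++ˡ (x ∷ xs) ys (suc k) (s≤s k<xs) = index-++ˡ xs ys k k<xs

  index-++ʳ : ∀ xs ys k → index (xs ++ ys) (length xs + k) ≡ index ys k
  index-++ʳ []       ys k = refl
  index-++ʳ (x ∷ xs) ys k = index-++ʳ xs ys k

  index-reverse : ∀ xs k → k < length xs → index (reverse xs) k ≡ index xs (length xs ∸ suc k)
  index-reverse (x ∷ xs) k k<1+xs rewrite unfold-reverse x xs with m≤n⇒m<n∨m≡n (≤-pred k<1+xs)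
  ... | inj₁ k<xs = begin
    index (reverse xs ++ [ x ]) k  ≡⟨ index-++ˡ (reverse xs) [ x ] k (subst (k <_) (sym (length-reverse xs)) k<xs) ⟩
    index (reverse xs) k           ≡⟨ index-reverse xs k k<xs ⟩
    index xs (length xs ∸ suc k)   ≡⟨ cong (index (x ∷ xs)) (+-∸-assoc 1 k<xs) ⟨
    index (x ∷ xs) (suc (length xs) ∸ suc k) ∎
    where open ≡-Reasoning
  ... | inj₂ refl = begin
    index (reverse xs ++ [ x ]) (length xs)
      ≡⟨ cong (index (reverse xs ++ [ x ])) (trans (+-identityʳ _) (length-reverse xs)) ⟨
    index (reverse xs ++ [ x ]) (length (reverse xs) + 0)
      ≡⟨ index-++ʳ (reverse xs) [ x ] 0 ⟩
    just x
      ≡⟨ cong (index (x ∷ xs)) (n∸n≡0 (length xs)) ⟨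
    index (x ∷ xs) (suc (length xs) ∸ suc (length xs)) ∎
    where open ≡-Reasoning

  letter-++ˡ : ∀ xs ys X → X ≤ length xs → letter (xs ++ ys) X ≡ letter xs X
  letter-++ˡ xs ys zero    _ = refl
  letter-++ˡ xs ys (suc k) k<xs = index-++ˡ xs ys k k<xs

  length-take-≤ : ∀ n (xs : List A) → n ≤ length xs → length (take n xs) ≡ n
  length-take-≤ n xs n≤xs = trans (length-take n xs) (m≤n⇒m⊓n≡m n≤xs)

  take-++ˡ : ∀ n (xs ys : List A) → n ≤ length xs → take n (xs ++ ys) ≡ take n xs
  take-++ˡ zero    xs       ys _ = refl
  take-++ˡ (suc n) (x ∷ xs) ys (s≤s n≤xs) = cong (x ∷_) (take-++ˡ n xs ys n≤xs)

  take-length-++ : ∀ (xs ys : List A) → take (length xs) (xs ++ ys) ≡ xs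
  take-length-++ []       ys = refl
  take-length-++ (x ∷ xs) ys = cong (x ∷_) (take-length-++ xs ys)

  take-drop-++ˡ : ∀ a m (xs ys : List A) → a + m ≤ length xs → take m (drop a (xs ++ ys)) ≡ take m (drop a xs)
  take-drop-++ˡ a m xs ys a+m≤xs = begin
    take m (drop a (xs ++ ys))    ≡⟨ take-drop m a (xs ++ ys) ⟩
    drop a (take (a + m) (xs ++ ys)) ≡⟨ cong (drop a) (take-++ˡ (a + m) xs ys a+m≤xs) ⟩
    drop a (take (a + m) xs)      ≡⟨ take-drop m a xs ⟨
    take m (drop a xs)            ∎
    where open ≡-Reasoning

  pal-suffix≡prefix : ∀ w k → reverse w ≡ w → reverse (drop k w) ≡ drop k w → take (length w ∸ k) w ≡ drop k w
  pal-suffix≡prefix w k palw palSuffix = begin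
    take (length w ∸ k) w                          ≡⟨ cong₂ take (sym (length-drop k w)) (sym palw) ⟩
    take ℓ (reverse w)                             ≡⟨ cong (take ℓ ∘ reverse) (take++drop≡id k w) ⟨
    take ℓ (reverse (take k w ++ drop k w))        ≡⟨ cong (take ℓ) (reverse-++ (take k w) (drop k w)) ⟩
    take ℓ (reverse (drop k w) ++ reverse (take k w)) ≡⟨ cong (λ v → take ℓ (v ++ reverse (take k w))) palSuffix ⟩
    take ℓ (drop k w ++ reverse (take k w))        ≡⟨ take-length-++ (drop k w) (reverse (take k w)) ⟩
    drop k w                                       ∎
    where
    open ≡-Reasoning
    ℓ = length (drop k w)

  reverse≡⇔index : ∀ w → reverse w ≡ w ⇔ (∀ k → k < length w → index w k ≡ index w (length w ∸ suc k))
  reverse≡⇔index w = mk⇔ to from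
    where
    to : reverse w ≡ w → ∀ k → k < length w → index w k ≡ index w (length w ∸ suc k)
    to rev≡w k k<w = trans (cong (λ v → index v k) (sym rev≡w)) (index-reverse w k k<w)
    from : (∀ k → k < length w → index w k ≡ index w (length w ∸ suc k)) → reverse w ≡ w
    from mirror = index-ext (reverse w) w same
      where
      same : ∀ k → index (reverse w) k ≡ index w k
      same k with k <? length w
      ... | yes k<w = trans (index-reverse w k k<w) (sym (mirror k k<w))
      ... | no  k≮w = trans (index-≥length (reverse w) k (subst (_≤ k) (sym (length-reverse w)) (≮⇒≥ k≮w)))
                            (sym (index-≥length w k (≮⇒≥ k≮w)))

  -- S[i..j] is a palindrome (vacuously when j < i); the factor of length m after position a is S[a+1..a+m]
  Pal : List A → ℕ → ℕ → Set
  Pal S i j = ∀ X Y → i ≤ X → X ≤ j → X + Y ≡ i + j → letter S X ≡ letter S Y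

  OccursAt : List A → ℕ → List A → Set
  OccursAt S a w = ∀ k → k < length w → index w k ≡ index S (a + k)

  OccursAt-IsPal⇔Pal : ∀ S a w → OccursAt S a w → reverse w ≡ w ⇔ Pal S (suc a) (a + length w)
  OccursAt-IsPal⇔Pal S a w occ = mk⇔ to from
    where
    mirror-sum : ∀ a k r → suc (a + k) + suc (a + r) ≡ suc a + (a + suc (k + r))
    mirror-sum = solve-∀
    to : reverse w ≡ w → Pal S (suc a) (a + length w)
    to rev≡w (suc X) Y (s≤s a≤X) X≤end sum with ≤⇒∃+ a≤X
    ... | k , refl with ≤⇒∃+ (+-cancelˡ-≤ a (suc k) (length w) (subst (_≤ a + length w) (sym (+-suc a k)) X≤end))
    ... | r , w≡ = begin
      index S (a + k)                  ≡⟨ occ k k<w ⟨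
      index w k                        ≡⟨ Equivalence.to (reverse≡⇔index w) rev≡w k k<w ⟩
      index w (length w ∸ suc k)       ≡⟨ cong (λ m → index w (m ∸ suc k)) w≡ ⟩
      index w (suc k + r ∸ suc k)      ≡⟨ cong (index w) (m+n∸m≡n (suc k) r) ⟩
      index w r                        ≡⟨ occ r r<w ⟩
      index S (a + r)                  ≡⟨ cong (letter S) Y≡ ⟨
      letter S Y                       ∎
      where
      open ≡-Reasoning
      k<w : k < length w
      k<w = subst (k <_) (sym w≡) (m≤m+n (suc k) r)
      r<w : r < length w
      r<w = subst (r <_) (sym w≡) (s≤s (m≤n+m r k))
      Y≡ : Y ≡ suc (a + r)
      Y≡ = +-cancelˡ-≡ (suc (a + k)) _ _ (trans sum (trans (cong (λ m → suc a + (a + m)) w≡) (sym (mirror-sum a k r))))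
    from : Pal S (suc a) (a + length w) → reverse w ≡ w
    from pal = Equivalence.from (reverse≡⇔index w) mirror
      where
      mirror : ∀ k → k < length w → index w k ≡ index w (length w ∸ suc k)
      mirror k k<w with ≤⇒∃+ k<w
      ... | r , w≡ = begin
        index w k                    ≡⟨ occ k k<w ⟩
        index S (a + k)              ≡⟨ pal (suc (a + k)) (suc (a + r)) (s≤s (m≤m+n a k)) k≤end sum ⟩
        index S (a + r)              ≡⟨ occ r r<w ⟨
        index w r                    ≡⟨ cong (index w) (m+n∸m≡n (suc k) r) ⟨
        index w (suc k + r ∸ suc k)  ≡⟨ cong (λ m → index w (m ∸ suc k)) w≡ ⟨
        index w (length w ∸ suc k)   ∎
        where
        open ≡-Reasoning
        r<w : r < length w
        r<w = subst (r <_) (sym w≡) (s≤s (m≤n+m r k))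
        k≤end : suc (a + k) ≤ a + length w
        k≤end = subst (suc (a + k) ≤_) (trans (sym (+-suc a (k + r))) (cong (a +_) (sym w≡)))
                      (s≤s (+-monoʳ-≤ a (m≤m+n k r)))
        sum : suc (a + k) + suc (a + r) ≡ suc a + (a + length w)
        sum = trans (mirror-sum a k r) (cong (λ m → suc a + (a + m)) (sym w≡))

  Pal-singleton : ∀ S i → Pal S i i
  Pal-singleton S i X Y i≤X X≤i sum with ≤-antisym X≤i i≤X
  ... | refl = cong (letter S) (+-cancelˡ-≡ X X Y (sym sum))

  Pal-≤end : ∀ {i j X Y} → i ≤ X → X + Y ≡ i + j → Y ≤ j
  Pal-≤end {i} {j} {X} {Y} i≤X sum = +-cancelˡ-≤ i Y j (subst (i + Y ≤_) sum (+-monoˡ-≤ Y i≤X))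

  Pal-agree : ∀ S S′ i j → (∀ X → X ≤ j → letter S X ≡ letter S′ X) → Pal S i j → Pal S′ i j
  Pal-agree S S′ i j agree pal X Y i≤X X≤j sum =
    trans (sym (agree X X≤j)) (trans (pal X Y i≤X X≤j sum) (agree Y (Pal-≤end i≤X sum)))

  Pal-++⁺ : ∀ s u i j → j ≤ length s → Pal s i j → Pal (s ++ u) i j
  Pal-++⁺ s u i j j≤s = Pal-agree s (s ++ u) i j (λ X X≤j → sym (letter-++ˡ s u X (≤-trans X≤j j≤s)))

  Pal-++⁻ : ∀ s u i j → j ≤ length s → Pal (s ++ u) i j → Pal s i j
  Pal-++⁻ s u i j j≤s = Pal-agree (s ++ u) s i j (λ X X≤j → letter-++ˡ s u X (≤-trans X≤j j≤s))

  Pal-mirror : ∀ S a u m v → Pal S (suc a) (a + (u + m + v)) → Pal S (suc (a + u)) (a + u + m)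
               → Pal S (suc (a + v)) (a + v + m)
  Pal-mirror S a u m v outer inner (suc X) Y (s≤s a+v≤X) X≤end sum with ≤⇒∃+ a+v≤X
  ... | w , refl with ≤⇒∃+ (+-cancelˡ-≤ (a + v) (suc w) m (subst (_≤ a + v + m) (sym (+-suc (a + v) w)) X≤end))
  ... | z , refl = begin
    letter S (suc (a + v + w))
      ≡⟨ outer _ _ (s≤s (m+n≡o⇒m≤o (v + w) (sym (+-assoc a v w)))) (m+n≡o⇒m≤o (u + z) (e₁ a u v w z)) (e₂ a u v w z) ⟩
    letter S (suc (a + u + z))
      ≡⟨ inner _ _ (s≤s (m≤m+n (a + u) z)) (m+n≡o⇒m≤o w (e₃ a u w z)) (e₄ a u w z) ⟩
    letter S (suc (a + u + w))
      ≡⟨ outer _ _ (s≤s (m+n≡o⇒m≤o (u + w) (sym (+-assoc a u w)))) (m+n≡o⇒m≤o (v + z) (e₅ a u v w z)) (e₆ a u v w z) ⟩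
    letter S (suc (a + v + z))
      ≡⟨ cong (letter S) Y≡ ⟨
    letter S Y ∎
    where
    open ≡-Reasoning
    e₁ : ∀ a u v w z → suc (a + v + w) + (u + z) ≡ a + (u + suc (w + z) + v)
    e₁ = solve-∀
    e₂ : ∀ a u v w z → suc (a + v + w) + suc (a + u + z) ≡ suc a + (a + (u + suc (w + z) + v))
    e₂ = solve-∀
    e₃ : ∀ a u w z → suc (a + u + z) + w ≡ a + u + suc (w + z)
    e₃ = solve-∀
    e₄ : ∀ a u w z → suc (a + u + z) + suc (a + u + w) ≡ suc (a + u) + (a + u + suc (w + z))
    e₄ = solve-∀
    e₅ : ∀ a u v w z → suc (a + u + w) + (v + z) ≡ a + (u + suc (w + z) + v)
    e₅ = solve-∀
    e₆ : ∀ a u v w z → suc (a + u + w) + suc (a + v + z) ≡ suc a + (a + (u + suc (w + z) + v))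
    e₆ = solve-∀
    e₇ : ∀ a v w z → suc (a + v) + (a + v + suc (w + z)) ≡ suc (a + v + w) + suc (a + v + z)
    e₇ = solve-∀
    Y≡ : Y ≡ suc (a + v + z)
    Y≡ = +-cancelˡ-≡ (suc (a + v + w)) Y _ (trans sum (e₇ a v w z))

  Pal-prefix⇒suffix : ∀ S a m v → Pal S (suc a) (a + (m + v)) → Pal S (suc a) (a + m) → Pal S (suc (a + v)) (a + v + m)
  Pal-prefix⇒suffix S a m v outer prefix =
    Pal-mirror S a 0 m v outer (subst (λ b → Pal S (suc b) (b + m)) (sym (+-identityʳ a)) prefix)

  Pal-suffix⇒prefix : ∀ S a u m → Pal S (suc a) (a + (u + m)) → Pal S (suc (a + u)) (a + u + m) → Pal S (suc a) (a + m)
  Pal-suffix⇒prefix S a u m outer suffix =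
    subst (λ b → Pal S (suc b) (b + m)) (+-identityʳ a)
      (Pal-mirror S a u m 0 (subst (λ e → Pal S (suc a) (a + e)) (sym (+-identityʳ (u + m))) outer) suffix)

  Pal-period : ∀ S p d N → Pal S p N → Pal S (p + d) N → ∀ y → p ≤ y → y + d ≤ N → letter S y ≡ letter S (y + d)
  Pal-period S p d N long short y p≤y y+d≤N with ≤⇒∃+ p≤y
  ... | u , refl with ≤⇒∃+ y+d≤N
  ... | v , refl =
    trans (long (p + u) (p + d + v) p≤y (≤-trans (m≤m+n (p + u) d) (m≤m+n _ v)) (e₁ p u d v))
          (sym (short (p + u + d) (p + d + v) (m+n≡o⇒m≤o u (e₂ p u d)) (m≤m+n _ v) (e₃ p u d v)))
    where
    e₁ : ∀ p u d v → p + u + (p + d + v) ≡ p + (p + u + d + v)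
    e₁ = solve-∀
    e₂ : ∀ p u d → p + d + u ≡ p + u + d
    e₂ = solve-∀
    e₃ : ∀ p u d v → p + u + d + (p + d + v) ≡ p + d + (p + u + d + v)
    e₃ = solve-∀

  Pal-periodic-mirror : ∀ S p d N → Pal S p N → Pal S (p + d) N → ∀ k X Y → p ≤ X → X ≤ N → p ≤ Y → Y ≤ N
                        → X + Y + k * d ≡ p + N → letter S X ≡ letter S Y
  Pal-periodic-mirror S p d N long short zero X Y p≤X X≤N p≤Y Y≤N sum =
    long X Y p≤X X≤N (trans (sym (+-identityʳ (X + Y))) sum)
  Pal-periodic-mirror S p d N long short (suc k) X Y p≤X X≤N p≤Y Y≤N sum =
    trans (Pal-periodic-mirror S p d N long short k X (Y + d) p≤X X≤N (≤-trans p≤Y (m≤m+n Y d)) Y+d≤N sum′)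
          (sym (Pal-period S p d N long short Y p≤Y Y+d≤N))
    where
    shift : ∀ X Y d k → X + Y + (d + k * d) ≡ X + (Y + d) + k * d
    shift = solve-∀
    sum′ : X + (Y + d) + k * d ≡ p + N
    sum′ = trans (sym (shift X Y d k)) sum
    Y+d≤N : Y + d ≤ N
    Y+d≤N = +-cancelˡ-≤ p (Y + d) N
      (≤-trans (+-monoˡ-≤ (Y + d) p≤X) (≤-trans (m≤m+n (X + (Y + d)) (k * d)) (≤-reflexive sum′)))

  -- S[p..N] has period d = i − p.  With l = p + ((N − j) mod d), the mirror sum l + j differs from p + N
  -- by a multiple of d, so every mirror pair of S[l..j] is a mirror pair of S[p..N] moved by whole periods.
  Pal-extendLeft : ∀ S p i j N → Pal S p N → Pal S i N → Pal S i j → p < i → j ≤ N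
                   → ∃ λ l → p ≤ l × l < i × Pal S l j
  Pal-extendLeft S p i j N long short pal p<i j≤N with ≤⇒∃+ p<i
  ... | d , refl = p + r , m≤m+n p r , <-≤-trans (+-monoʳ-< p (m%n<n (N ∸ j) D)) (≤-reflexive (+-suc p d)) , pal′
    where
    D = suc d
    r = (N ∸ j) % D
    k = (N ∸ j) / D
    N≡ : N ≡ j + (r + k * D)
    N≡ = trans (sym (m+[n∸m]≡n j≤N)) (cong (j +_) (m≡m%n+[m/n]*n (N ∸ j) D))
    pal′ : Pal S (p + r) j
    pal′ X Y l≤X X≤j sum =
      Pal-periodic-mirror S p D N long (subst (λ e → Pal S e N) (sym (+-suc p d)) short) k X Y
        (≤-trans (m≤m+n p r) l≤X) (≤-trans X≤j j≤N) (≤-trans (m≤m+n p r) l≤Y) (≤-trans (Pal-≤end l≤X sum) j≤N)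
        (trans (cong (_+ k * D) sum) (trans (e p r k D j) (cong (p +_) (sym N≡))))
      where
      l≤Y : p + r ≤ Y
      l≤Y = +-cancelʳ-≤ j (p + r) Y (subst (_≤ Y + j) sum (subst (X + Y ≤_) (+-comm j Y) (+-monoˡ-≤ Y X≤j)))
      e : ∀ p r k D j → p + r + j + k * D ≡ p + (j + (r + k * D))
      e = solve-∀

  RightMaximal : List A → ℕ → ℕ → Set
  RightMaximal S i j = ∀ r → j < r → r ≤ length S → ¬ Pal S i r

  LeftMaximal : List A → ℕ → ℕ → Set
  LeftMaximal S i j = ∀ l → 1 ≤ l → l < i → ¬ Pal S l j

  record IsSurface (S : List A) (i j : ℕ) : Set where
    field
      1≤start      : 1 ≤ i
      start≤end    : i ≤ j
      end≤length   : j ≤ length S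
      palindrome   : Pal S i j
      rightMaximal : RightMaximal S i j
      leftMaximal  : LeftMaximal S i j

  record LongestPalFrom (S : List A) (i E : ℕ) : Set where
    field
      start≤end    : i ≤ E
      end≤length   : E ≤ length S
      palindrome   : Pal S i E
      rightMaximal : RightMaximal S i E

  LongestPalFrom-unique : ∀ {S i E E′} → LongestPalFrom S i E → LongestPalFrom S i E′ → E ≡ E′
  LongestPalFrom-unique long long′ = ≤-antisym (≤longest long long′) (≤longest long′ long)
    where
    ≤longest : ∀ {S i E E′} → LongestPalFrom S i E → LongestPalFrom S i E′ → E ≤ E′
    ≤longest long long′ = ≮⇒≥ λ E′<E →
      LongestPalFrom.rightMaximal long′ _ E′<E (LongestPalFrom.end≤length long) (LongestPalFrom.palindrome long)

  LongestPalFrom-toEnd : ∀ (S : List A) i → i ≤ length S → Pal S i (length S) → LongestPalFrom S i (length S)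
  LongestPalFrom-toEnd S i i≤S pal = record
    { start≤end = i≤S ; end≤length = ≤-refl ; palindrome = pal
    ; rightMaximal = λ r S<r r≤S _ → <-irrefl refl (<-≤-trans S<r r≤S) }

  LongestPalFrom⇒IsSurface : ∀ {S i E} → 1 ≤ i → LongestPalFrom S i E → LeftMaximal S i E → IsSurface S i E
  LongestPalFrom⇒IsSurface 1≤i long lmax = record
    { 1≤start = 1≤i ; start≤end = start≤end ; end≤length = end≤length
    ; palindrome = palindrome ; rightMaximal = rightMaximal ; leftMaximal = lmax }
    where open LongestPalFrom long

  record LongestPalTo (S : List A) (b i : ℕ) : Set where
    field
      palindrome  : Pal S b i
      leftMaximal : LeftMaximal S b i

Greatest : (ℕ → Set) → ℕ → ℕ → Set
Greatest P bound n = n ≤ bound × P n × (∀ m → n < m → m ≤ bound → ¬ P m)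

SearchesDown : (ℕ → Set) → (ℕ → ℕ) → Set
SearchesDown P f = ∀ k → (P (suc k) × f (suc k) ≡ suc k) ⊎ (¬ P (suc k) × f (suc k) ≡ f k)

search-greatest : ∀ {P f} → f 0 ≡ 0 → P 0 → SearchesDown P f → ∀ bound → Greatest P bound (f bound)
search-greatest {P} {f} f0≡0 P0 step zero rewrite f0≡0 = z≤n , P0 , λ m 0<m m≤0 _ → <-irrefl refl (<-≤-trans 0<m m≤0)
search-greatest {P} {f} f0≡0 P0 step (suc b) with step b
... | inj₁ (Pb , fb≡) rewrite fb≡ = ≤-refl , Pb , λ m b<m m≤b _ → <-irrefl refl (<-≤-trans b<m m≤b)
... | inj₂ (¬Pb , fb≡) rewrite fb≡ with search-greatest f0≡0 P0 step b
...   | f≤b , Pf , above = m≤n⇒m≤1+n f≤b , Pf , above′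
  where
  above′ : ∀ m → f b < m → m ≤ suc b → ¬ P m
  above′ m f<m m≤1+b with m≤n⇒m<n∨m≡n m≤1+b
  ... | inj₁ m<1+b = above m f<m (≤-pred m<1+b)
  ... | inj₂ refl  = ¬Pb

module Surfaces {A : Set} (_≟_ : DecidableEquality A) where
  open Strings _≟_

  Pal-slice : ∀ S a m → a + m ≤ length S → IsPal (take m (drop a S)) ⇔ Pal S (suc a) (a + m)
  Pal-slice S a m a+m≤S = subst (λ len → IsPal w ⇔ Pal S (suc a) (a + len)) len≡ (OccursAt-IsPal⇔Pal S a w occ)
    where
    w = take m (drop a S)
    len≡ : length w ≡ m
    len≡ = length-take-≤ m (drop a S)
             (subst (m ≤_) (sym (length-drop a S)) (m+n≤o⇒m≤o∸n m (subst (_≤ length S) (+-comm a m) a+m≤S)))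
    occ : OccursAt S a w
    occ k k<w = trans (index-take m (drop a S) k (subst (k <_) len≡ k<w)) (index-drop a S k)

  Pal-sub : ∀ S a j → a ≤ j → j ≤ length S → IsPal (sub S (suc a) j) ⇔ Pal S (suc a) j
  Pal-sub S a j a≤j j≤S = subst (λ e → IsPal (sub S (suc a) j) ⇔ Pal S (suc a) e) (m+[n∸m]≡n a≤j)
    (Pal-slice S a (j ∸ a) (subst (_≤ length S) (sym (m+[n∸m]≡n a≤j)) j≤S))

  Pal-suffixOfPrefix : ∀ S i k → k ≤ i → i ≤ length S → IsPal (drop (i ∸ k) (take i S)) ⇔ Pal S (suc (i ∸ k)) i
  Pal-suffixOfPrefix S i k k≤i i≤S = subst₂ (λ w e → IsPal w ⇔ Pal S (suc (i ∸ k)) e) slice≡ (m∸n+n≡m k≤i)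
    (Pal-slice S (i ∸ k) k (subst (_≤ length S) (sym (m∸n+n≡m k≤i)) i≤S))
    where
    slice≡ : take k (drop (i ∸ k) S) ≡ drop (i ∸ k) (take i S)
    slice≡ = trans (take-drop k (i ∸ k) S) (cong (λ e → drop (i ∸ k) (take e S)) (m∸n+n≡m k≤i))

  Pal? : ∀ S a j → a ≤ j → j ≤ length S → Dec (Pal S (suc a) j)
  Pal? S a j a≤j j≤S = Dec.map (Pal-sub S a j a≤j j≤S) (isPal? (sub S (suc a) j))

  Surface⇔IsSurface : ∀ S i j → Surface S i j ⇔ IsSurface S i j
  Surface⇔IsSurface S i j = mk⇔ to from
    where
    to : Surface S i j → IsSurface S i j
    to (1≤i@(s≤s {n = a} z≤n) , i≤j , j≤S , pal , rmax , lmax) = record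
      { 1≤start = 1≤i ; start≤end = i≤j ; end≤length = j≤S
      ; palindrome = Equivalence.to (Pal-sub S a j (<⇒≤ i≤j) j≤S) pal
      ; rightMaximal = λ r j<r r≤S p → rmax r j<r r≤S
          (Equivalence.from (Pal-sub S a r (<⇒≤ (<-≤-trans i≤j (<⇒≤ j<r))) r≤S) p)
      ; leftMaximal = λ { (suc l) 1≤l l<i p → lmax (suc l) 1≤l l<i
          (Equivalence.from (Pal-sub S l j (≤-trans (n≤1+n l) (<⇒≤ (<-≤-trans l<i i≤j))) j≤S) p) } }
    from : IsSurface S i j → Surface S i j
    from record { 1≤start = 1≤i@(s≤s {n = a} z≤n) ; start≤end = i≤j ; end≤length = j≤S
                ; palindrome = pal ; rightMaximal = rmax ; leftMaximal = lmax } =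
      1≤i , i≤j , j≤S , Equivalence.from (Pal-sub S a j (<⇒≤ i≤j) j≤S) pal ,
      (λ r j<r r≤S p → rmax r j<r r≤S (Equivalence.to (Pal-sub S a r (<⇒≤ (<-≤-trans i≤j (<⇒≤ j<r))) r≤S) p)) ,
      λ { (suc l) 1≤l l<i p → lmax (suc l) 1≤l l<i (Equivalence.to (Pal-sub S l j (≤-trans (n≤1+n l) (<⇒≤ (<-≤-trans l<i i≤j))) j≤S) p) }

  IsSurface? : ∀ S i j → Dec (IsSurface S i j)
  IsSurface? S i j = Dec.map (Surface⇔IsSurface S i j) (surface? S i j)

  presurf-surface : ∀ S i → IsSurface S i (i + prelen S i ∸ 1) → presurf S i ≡ prepal S i
  presurf-surface S i surf with surface? S i (i + prelen S i ∸ 1)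
  ... | yes _     = refl
  ... | no ¬surf  = ⊥-elim (¬surf (Equivalence.from (Surface⇔IsSurface S i _) surf))

  presurf-¬surface : ∀ S i → ¬ IsSurface S i (i + prelen S i ∸ 1) → presurf S i ≡ []
  presurf-¬surface S i ¬surf with surface? S i (i + prelen S i ∸ 1)
  ... | yes surf = ⊥-elim (¬surf (Equivalence.to (Surface⇔IsSurface S i _) surf))
  ... | no _     = refl

  sufsurf-surface : ∀ S i → IsSurface S (suc i ∸ suflen S i) i → sufsurf S i ≡ sufpal S i
  sufsurf-surface S i surf with surface? S (suc i ∸ suflen S i) i
  ... | yes _     = refl
  ... | no ¬surf  = ⊥-elim (¬surf (Equivalence.from (Surface⇔IsSurface S _ i) surf))

  sufsurf-¬surface : ∀ S i → ¬ IsSurface S (suc i ∸ suflen S i) i → sufsurf S i ≡ []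
  sufsurf-¬surface S i ¬surf with surface? S (suc i ∸ suflen S i) i
  ... | yes surf = ⊥-elim (¬surf (Equivalence.to (Surface⇔IsSurface S _ i) surf))
  ... | no _     = refl

  presurf-≡ : ∀ S S′ i → prepal S i ≡ prepal S′ i
              → IsSurface S i (i + prelen S i ∸ 1) ⇔ IsSurface S′ i (i + prelen S′ i ∸ 1)
              → presurf S i ≡ presurf S′ i
  presurf-≡ S S′ i prepal≡ surface⇔ with IsSurface? S i (i + prelen S i ∸ 1)
  ... | yes surf = trans (presurf-surface S i surf)
                         (trans prepal≡ (sym (presurf-surface S′ i (Equivalence.to surface⇔ surf))))
  ... | no ¬surf = trans (presurf-¬surface S i ¬surf)
                         (sym (presurf-¬surface S′ i (λ surf′ → ¬surf (Equivalence.from surface⇔ surf′))))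

  sufsurf-≡ : ∀ S S′ i → sufpal S i ≡ sufpal S′ i
              → IsSurface S (suc i ∸ suflen S i) i ⇔ IsSurface S′ (suc i ∸ suflen S′ i) i
              → sufsurf S i ≡ sufsurf S′ i
  sufsurf-≡ S S′ i sufpal≡ surface⇔ with IsSurface? S (suc i ∸ suflen S i) i
  ... | yes surf = trans (sufsurf-surface S i surf)
                         (trans sufpal≡ (sym (sufsurf-surface S′ i (Equivalence.to surface⇔ surf))))
  ... | no ¬surf = trans (sufsurf-¬surface S i ¬surf)
                         (sym (sufsurf-¬surface S′ i (λ surf′ → ¬surf (Equivalence.from surface⇔ surf′))))

  palPrefSearch-greatest : ∀ u bound → Greatest (λ k → IsPal (take k u)) bound (palPrefSearch u bound)
  palPrefSearch-greatest u = search-greatest refl refl step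
    where
    step : SearchesDown (λ k → IsPal (take k u)) (palPrefSearch u)
    step k with isPal? (take (suc k) u)
    ... | yes pal = inj₁ (pal , refl)
    ... | no ¬pal = inj₂ (¬pal , refl)

  palSufSearch-greatest : ∀ w bound → Greatest (λ k → IsPal (drop (length w ∸ k) w)) bound (palSufSearch w bound)
  palSufSearch-greatest w = search-greatest refl empty step
    where
    empty : IsPal (drop (length w) w)
    empty = subst IsPal (sym (drop-all (length w) w ≤-refl)) refl
    step : SearchesDown (λ k → IsPal (drop (length w ∸ k) w)) (palSufSearch w)
    step k with isPal? (drop (length w ∸ suc k) w)
    ... | yes pal = inj₁ (pal , refl)
    ... | no ¬pal = inj₂ (¬pal , refl)

  prelen-spec : ∀ S i₀ → suc i₀ ≤ length S → LongestPalFrom S (suc i₀) (i₀ + prelen S (suc i₀))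
  prelen-spec S i₀ i≤S = record
    { start≤end = ≮⇒≥ (λ E<i → rmax (suc i₀) E<i i≤S (Pal-singleton S (suc i₀)))
    ; end≤length = E≤S ; palindrome = Equivalence.to (Pal-slice S i₀ L E≤S) pal ; rightMaximal = rmax }
    where
    u = drop i₀ S
    L = prelen S (suc i₀)
    greatest = palPrefSearch-greatest u (length u)
    L≤u : L ≤ length S ∸ i₀
    L≤u = subst (L ≤_) (length-drop i₀ S) (proj₁ greatest)
    pal : IsPal (take L u)
    pal = proj₁ (proj₂ greatest)
    E≤S : i₀ + L ≤ length S
    E≤S = subst (_≤ length S) (+-comm L i₀) (m≤o∸n⇒m+n≤o L (<⇒≤ i≤S) L≤u)
    rmax : RightMaximal S (suc i₀) (i₀ + L)
    rmax r E<r r≤S palr = proj₂ (proj₂ greatest) (r ∸ i₀) L<k k≤u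
      (Equivalence.from (Pal-slice S i₀ (r ∸ i₀) (subst (_≤ length S) (sym r≡) r≤S)) (subst (Pal S (suc i₀)) (sym r≡) palr))
      where
      r≡ : i₀ + (r ∸ i₀) ≡ r
      r≡ = m+[n∸m]≡n (≤-trans (m≤m+n i₀ L) (<⇒≤ E<r))
      L<k : L < r ∸ i₀
      L<k = +-cancelˡ-< i₀ L (r ∸ i₀) (subst (i₀ + L <_) (sym r≡) E<r)
      k≤u : r ∸ i₀ ≤ length u
      k≤u = subst (r ∸ i₀ ≤_) (sym (length-drop i₀ S)) (∸-monoˡ-≤ i₀ r≤S)

  suflen-spec : ∀ S i → i ≤ length S → suflen S i ≤ i × LongestPalTo S (suc (i ∸ suflen S i)) i
  suflen-spec S i i≤S = K≤i , record { palindrome = Equivalence.to (Pal-suffixOfPrefix S i K K≤i i≤S) pal ; leftMaximal = lmax }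
    where
    w = take i S
    K = suflen S i
    w≡i : length w ≡ i
    w≡i = length-take-≤ i S i≤S
    greatest = palSufSearch-greatest w (length w)
    K≤i : K ≤ i
    K≤i = subst (K ≤_) w≡i (proj₁ greatest)
    pal : IsPal (drop (i ∸ K) w)
    pal = subst (λ e → IsPal (drop (e ∸ K) w)) w≡i (proj₁ (proj₂ greatest))
    lmax : LeftMaximal S (suc (i ∸ K)) i
    lmax (suc l) _ (s≤s l<b) pall = proj₂ (proj₂ greatest) k K<k (subst (k ≤_) (sym w≡i) (m∸n≤m i l))
      (subst (λ e → IsPal (drop (e ∸ k) w)) (sym w≡i)
        (Equivalence.from (Pal-suffixOfPrefix S i k (m∸n≤m i l) i≤S) (subst (λ e → Pal S (suc e) i) (sym i∸k≡l) pall)))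
      where
      k = i ∸ l
      i∸k≡l : i ∸ k ≡ l
      i∸k≡l = m∸[m∸n]≡n (<⇒≤ (≤-trans l<b (m∸n≤m i K)))
      K<k : K < k
      K<k = m+n≤o⇒m≤o∸n (suc K) (subst (_≤ i) (cong suc (+-comm l K)) (m≤o∸n⇒m+n≤o (suc l) K≤i l<b))

  Pal-suffix : ∀ S k → k ≤ length S → IsPal (drop (length S ∸ k) S) ⇔ Pal S (suc (length S ∸ k)) (length S)
  Pal-suffix S k k≤S = subst (λ w → IsPal (drop (length S ∸ k) w) ⇔ Pal S (suc (length S ∸ k)) (length S))
    (take-all (length S) S ≤-refl) (Pal-suffixOfPrefix S (length S) k k≤S ≤-refl)

  length-sufpal : ∀ S i → i ≤ length S → length (sufpal S i) ≡ suflen S i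
  length-sufpal S i i≤S = trans (length-drop (length w ∸ suflen S i) w)
    (m∸[m∸n]≡n (subst (suflen S i ≤_) (sym w≡i) (proj₁ (suflen-spec S i i≤S))))
    where
    w = take i S
    w≡i : length w ≡ i
    w≡i = length-take-≤ i S i≤S

  sufStart : ∀ S i → i ≤ length S → suc i ∸ suflen S i ≡ suc (i ∸ suflen S i)
  sufStart S i i≤S = +-∸-assoc 1 (proj₁ (suflen-spec S i i≤S))

module Snoc {A : Set} (_≟_ : DecidableEquality A) (s : List A) (c : A) where
  open Strings _≟_
  open Surfaces _≟_

  S : List A
  S = s ++ [ c ]

  n N : ℕ
  n = length s
  N = length S

  N≡1+n : N ≡ suc n
  N≡1+n = trans (length-++ s) (+-comm n 1)

  ≤n⇒<N : ∀ {j} → j ≤ n → j < N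
  ≤n⇒<N j≤n = <-≤-trans (s≤s j≤n) (≤-reflexive (sym N≡1+n))

  ≤n⇒≤N : ∀ {j} → j ≤ n → j ≤ N
  ≤n⇒≤N j≤n = <⇒≤ (≤n⇒<N j≤n)

  <N⇒≤n : ∀ {j} → j < N → j ≤ n
  <N⇒≤n j<N = ≤-pred (subst (_ <_) N≡1+n j<N)

  Pal-S⇒s : ∀ {i j} → j ≤ n → Pal S i j → Pal s i j
  Pal-S⇒s {i} {j} = Pal-++⁻ s [ c ] i j

  Pal-s⇒S : ∀ {i j} → j ≤ n → Pal s i j → Pal S i j
  Pal-s⇒S {i} {j} = Pal-++⁺ s [ c ] i j

  t : List A
  t = sufpal S N

  opaque
    T : ℕ
    T = suflen S N

    suflen≡T : suflen S N ≡ T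
    suflen≡T = refl

  P : ℕ
  P = N ∸ T

  T≤N : T ≤ N
  T≤N = subst (_≤ N) suflen≡T (proj₁ (suflen-spec S N ≤-refl))

  P+T≡N : P + T ≡ N
  P+T≡N = m∸n+n≡m T≤N

  t-longest : LongestPalTo S (suc P) N
  t-longest = subst (λ k → LongestPalTo S (suc (N ∸ k)) N) suflen≡T (proj₂ (suflen-spec S N ≤-refl))

  t-pal : Pal S (suc P) N
  t-pal = LongestPalTo.palindrome t-longest

  t-start-least : ∀ a → Pal S (suc a) N → P ≤ a
  t-start-least a pal = ≮⇒≥ λ a<P → LongestPalTo.leftMaximal t-longest (suc a) (s≤s z≤n) (s≤s a<P) pal

  P<N : P < N
  P<N = <-≤-trans (s≤s (t-start-least n (subst (λ e → Pal S e N) N≡1+n (Pal-singleton S N)))) (≤-reflexive (sym N≡1+n))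

  t≡ : t ≡ drop P S
  t≡ = cong₂ (λ w k → drop (length w ∸ k) w) (take-all N S ≤-refl) suflen≡T

  length-t : length t ≡ T
  length-t = trans (cong length t≡) (trans (length-drop P S) (m∸[m∸n]≡n T≤N))

  t-IsPal : IsPal t
  t-IsPal = proj₁ (proj₂ (palSufSearch-greatest (take N S) (length (take N S))))

  drop-t : ∀ k → k ≤ T → drop (length t ∸ k) t ≡ drop (N ∸ k) S
  drop-t k k≤T = begin
    drop (length t ∸ k) t    ≡⟨ cong₂ (λ e w → drop (e ∸ k) w) length-t t≡ ⟩
    drop (T ∸ k) (drop P S)  ≡⟨ drop-drop P (T ∸ k) S ⟩
    drop (P + (T ∸ k)) S     ≡⟨ cong (λ e → drop e S) (trans (sym (+-∸-assoc P k≤T)) (cong (_∸ k) P+T≡N)) ⟩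
    drop (N ∸ k) S           ∎
    where open ≡-Reasoning

  t′ : List A
  t′ = longestProperPalSuffix t

  opaque
    T′ : ℕ
    T′ = palSufSearch t (length t ∸ 1)

    t′≡drop : t′ ≡ drop (length t ∸ T′) t
    t′≡drop = refl

    t′-greatest : Greatest (λ k → IsPal (drop (length t ∸ k) t)) (length t ∸ 1) T′
    t′-greatest = palSufSearch-greatest t (length t ∸ 1)

  Q′ : ℕ
  Q′ = N ∸ T′

  0<T : 0 < T
  0<T = subst (0 <_) (m∸[m∸n]≡n T≤N) (m<n⇒0<n∸m P<N)

  T′<T : T′ < T
  T′<T = <-≤-trans (s≤s (subst (λ e → T′ ≤ e ∸ 1) length-t (proj₁ t′-greatest))) (≤-reflexive (m+[n∸m]≡n 0<T))

  T′≤N : T′ ≤ N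
  T′≤N = ≤-trans (<⇒≤ T′<T) T≤N

  Q′+T′≡N : Q′ + T′ ≡ N
  Q′+T′≡N = m∸n+n≡m T′≤N

  length-t′ : length t′ ≡ T′
  length-t′ = trans (cong length t′≡drop) (trans (length-drop (length t ∸ T′) t) (m∸[m∸n]≡n (subst (T′ ≤_) (sym length-t) (<⇒≤ T′<T))))

  t′-pal : Pal S (suc Q′) N
  t′-pal = Equivalence.to (Pal-suffix S T′ T′≤N) (subst IsPal (drop-t T′ (<⇒≤ T′<T)) (proj₁ (proj₂ t′-greatest)))

  t′-max : ∀ a → P < a → a < Q′ → ¬ Pal S (suc a) N
  t′-max a P<a a<Q′ pal = proj₂ (proj₂ t′-greatest) k T′<k k≤t
    (subst IsPal (sym (drop-t k k≤T)) (Equivalence.from (Pal-suffix S k (m∸n≤m N a)) (subst (λ e → Pal S (suc e) N) (sym N∸k≡a) pal)))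
    where
    k = N ∸ a
    a≤N : a ≤ N
    a≤N = ≤-trans (<⇒≤ a<Q′) (m∸n≤m N T′)
    N∸k≡a : N ∸ k ≡ a
    N∸k≡a = m∸[m∸n]≡n a≤N
    T′<k : T′ < k
    T′<k = m+n≤o⇒m≤o∸n (suc T′) (subst (_≤ N) (cong suc (+-comm a T′)) (m≤o∸n⇒m+n≤o (suc a) T′≤N a<Q′))
    k<T : k < T
    k<T = subst (k <_) (m∸[m∸n]≡n T≤N) (∸-monoʳ-< P<a a≤N)
    k≤T : k ≤ T
    k≤T = <⇒≤ k<T
    k≤t : k ≤ length t ∸ 1
    k≤t = subst (λ e → k ≤ e ∸ 1) (sym length-t) (≤-pred (≤-trans k<T (≤-reflexive (sym (m+[n∸m]≡n 0<T)))))

  take-t≡t′ : take T′ t ≡ t′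
  take-t≡t′ = trans (cong (λ e → take e t) (sym (m∸[m∸n]≡n (subst (T′ ≤_) (sym length-t) (<⇒≤ T′<T)))))
                    (trans (pal-suffix≡prefix t (length t ∸ T′) t-IsPal (proj₁ (proj₂ t′-greatest))) (sym t′≡drop))

  IsSurface-snoc⇔ : ∀ {i j} → j ≤ n → ¬ Pal S i N → IsSurface s i j ⇔ IsSurface S i j
  IsSurface-snoc⇔ {i} {j} j≤n ¬palN = mk⇔ to from
    where
    to : IsSurface s i j → IsSurface S i j
    to surf = record
      { 1≤start = 1≤start ; start≤end = start≤end ; end≤length = ≤n⇒≤N j≤n
      ; palindrome = Pal-s⇒S j≤n palindrome ; rightMaximal = rmax
      ; leftMaximal = λ l 1≤l l<i pal → leftMaximal l 1≤l l<i (Pal-S⇒s j≤n pal) }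
      where
      open IsSurface surf
      rmax : RightMaximal S i j
      rmax r j<r r≤N pal with m≤n⇒m<n∨m≡n r≤N
      ... | inj₁ r<N = rightMaximal r j<r (<N⇒≤n r<N) (Pal-S⇒s (<N⇒≤n r<N) pal)
      ... | inj₂ refl = ¬palN pal
    from : IsSurface S i j → IsSurface s i j
    from surf = record
      { 1≤start = 1≤start ; start≤end = start≤end ; end≤length = j≤n
      ; palindrome = Pal-S⇒s j≤n palindrome
      ; rightMaximal = λ r j<r r≤n pal → rightMaximal r j<r (≤n⇒≤N r≤n) (Pal-s⇒S r≤n pal)
      ; leftMaximal = λ l 1≤l l<i pal → leftMaximal l 1≤l l<i (Pal-s⇒S j≤n pal) }
      where open IsSurface surf

  t-surface : IsSurface S (suc P) N
  t-surface = LongestPalFrom⇒IsSurface (s≤s z≤n) (LongestPalFrom-toEnd S (suc P) P<N t-pal) (LongestPalTo.leftMaximal t-longest)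

  presurf-t-start : presurf S (suc P) ≡ t
  presurf-t-start = begin
    presurf S (suc P)  ≡⟨ presurf-surface S (suc P) (subst (IsSurface S (suc P)) (sym E≡N) t-surface) ⟩
    take L (drop P S)  ≡⟨ take-all L (drop P S) (≤-reflexive (trans (length-drop P S) (trans (cong (_∸ P) (sym E≡N)) (m+n∸m≡n P L)))) ⟩
    drop P S           ≡⟨ t≡ ⟨
    t                  ∎
    where
    open ≡-Reasoning
    L = prelen S (suc P)
    E≡N : P + L ≡ N
    E≡N = LongestPalFrom-unique (prelen-spec S P P<N) (LongestPalFrom-toEnd S (suc P) P<N t-pal)

  presurf-end : ∀ i₀ → suc i₀ ≡ N → T ≢ 1 → presurf S (suc i₀) ≡ []
  presurf-end i₀ i≡N T≢1 = presurf-¬surface S (suc i₀) λ surf →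
    IsSurface.leftMaximal surf (suc P) (s≤s z≤n) P+1<i (subst (Pal S (suc P)) (sym E≡N) t-pal)
    where
    i≤N = ≤-reflexive i≡N
    E≡N : i₀ + prelen S (suc i₀) ≡ N
    E≡N = LongestPalFrom-unique (prelen-spec S i₀ i≤N)
            (LongestPalFrom-toEnd S (suc i₀) i≤N (subst (Pal S (suc i₀)) i≡N (Pal-singleton S (suc i₀))))
    1<T : 1 < T
    1<T = ≤∧≢⇒< 0<T (λ 1≡T → T≢1 (sym 1≡T))
    P+1<i : suc P < suc i₀
    P+1<i = subst₂ _≤_ (+-comm P 2) (trans P+T≡N (sym i≡N)) (+-monoʳ-≤ P 1<T)

  ¬LeftMaximal-s : ∀ {b j} → j ≤ n → Pal S b N → suc P < b → Pal s b j → ¬ LeftMaximal s b j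
  ¬LeftMaximal-s {b} {j} j≤n palN P<b pal lmax =
    let l , P<l , l<b , palₗ = Pal-extendLeft S (suc P) b j N t-pal palN (Pal-s⇒S j≤n pal) P<b (≤n⇒≤N j≤n)
    in lmax l (≤-trans (s≤s z≤n) P<l) l<b (Pal-S⇒s j≤n palₗ)

  presurf-palToEnd : ∀ i₀ → suc i₀ ≤ n → suc i₀ ≢ suc P → Pal S (suc i₀) N
                     → presurf S (suc i₀) ≡ presurf s (suc i₀)
  presurf-palToEnd i₀ i≤n i≢P+1 palN = trans (presurf-¬surface S (suc i₀) ¬surfS) (sym (presurf-¬surface s (suc i₀) ¬surfs))
    where
    P<i₀ : P < i₀
    P<i₀ = ≤∧≢⇒< (t-start-least i₀ palN) (λ P≡i₀ → i≢P+1 (cong suc (sym P≡i₀)))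
    E≡N : i₀ + prelen S (suc i₀) ≡ N
    E≡N = LongestPalFrom-unique (prelen-spec S i₀ (≤n⇒≤N i≤n)) (LongestPalFrom-toEnd S (suc i₀) (≤n⇒≤N i≤n) palN)
    ¬surfS : ¬ IsSurface S (suc i₀) (i₀ + prelen S (suc i₀))
    ¬surfS surf = IsSurface.leftMaximal surf (suc P) (s≤s z≤n) (s≤s P<i₀) (subst (Pal S (suc P)) (sym E≡N) t-pal)
    ¬surfs : ¬ IsSurface s (suc i₀) (i₀ + prelen s (suc i₀))
    ¬surfs surf = ¬LeftMaximal-s end≤length palN (s≤s P<i₀) palindrome leftMaximal
      where open IsSurface surf

  presurf-¬palToEnd : ∀ i₀ → suc i₀ ≤ n → ¬ Pal S (suc i₀) N → presurf S (suc i₀) ≡ presurf s (suc i₀)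
  presurf-¬palToEnd i₀ i≤n ¬palN = sym (presurf-≡ s S (suc i₀) prepal≡ surface⇔)
    where
    open LongestPalFrom (prelen-spec S i₀ (≤n⇒≤N i≤n))
    E = i₀ + prelen S (suc i₀)
    E≤n : E ≤ n
    E≤n = <N⇒≤n (≤∧≢⇒< end≤length (λ E≡N → ¬palN (subst (Pal S (suc i₀)) E≡N palindrome)))
    longs : LongestPalFrom s (suc i₀) E
    longs = record
      { start≤end = start≤end ; end≤length = E≤n ; palindrome = Pal-S⇒s E≤n palindrome
      ; rightMaximal = λ r E<r r≤n pal → rightMaximal r E<r (≤n⇒≤N r≤n) (Pal-s⇒S r≤n pal) }
    prelen≡ : prelen s (suc i₀) ≡ prelen S (suc i₀)
    prelen≡ = +-cancelˡ-≡ i₀ _ _ (LongestPalFrom-unique (prelen-spec s i₀ i≤n) longs)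
    prepal≡ : prepal s (suc i₀) ≡ prepal S (suc i₀)
    prepal≡ = trans (cong (λ L → take L (drop i₀ s)) prelen≡) (sym (take-drop-++ˡ i₀ (prelen S (suc i₀)) s [ c ] E≤n))
    surface⇔ : IsSurface s (suc i₀) (i₀ + prelen s (suc i₀)) ⇔ IsSurface S (suc i₀) E
    surface⇔ = subst (λ L → IsSurface s (suc i₀) (i₀ + L) ⇔ IsSurface S (suc i₀) E) (sym prelen≡) (IsSurface-snoc⇔ E≤n ¬palN)

  presurf-elsewhere : ∀ i₀ → suc i₀ ≤ n → suc i₀ ≢ suc P → presurf S (suc i₀) ≡ presurf s (suc i₀)
  presurf-elsewhere i₀ i≤n i≢P+1 = [ presurf-palToEnd i₀ i≤n i≢P+1 , presurf-¬palToEnd i₀ i≤n ]′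
    (toSum (Pal? S i₀ N (≤-trans (n≤1+n i₀) (≤n⇒≤N i≤n)) ≤-refl))

  take-S : ∀ i → i ≤ n → take i S ≡ take i s
  take-S i = take-++ˡ i s [ c ]

  suflen-S : ∀ i → i ≤ n → suflen S i ≡ suflen s i
  suflen-S i i≤n = cong (λ w → palSufSearch w (length w)) (take-S i i≤n)

  sufpal-S : ∀ i → i ≤ n → sufpal S i ≡ sufpal s i
  sufpal-S i i≤n = cong (λ w → drop (length w ∸ palSufSearch w (length w)) w) (take-S i i≤n)

  sufStart-S : ∀ i → i ≤ n → suc i ∸ suflen S i ≡ suc (i ∸ suflen s i)
  sufStart-S i i≤n = trans (cong (suc i ∸_) (suflen-S i i≤n)) (sufStart s i i≤n)

  sufsurf-end : sufsurf S N ≡ t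
  sufsurf-end = sufsurf-surface S N (subst (λ b → IsSurface S b N) (sym t-start) t-surface)
    where
    t-start : suc N ∸ suflen S N ≡ suc P
    t-start = trans (sufStart S N ≤-refl) (cong (λ k → suc (N ∸ k)) suflen≡T)

  P+T′<N : P + T′ < N
  P+T′<N = subst (P + T′ <_) P+T≡N (+-monoʳ-< P T′<T)

  -- Mirrored inside t, the surface becomes a proper palindromic suffix of t, so m ≤ T′;
  -- mirrored inside t, t′ becomes a palindrome of s starting at P + 1, so T′ ≤ m.
  surface-at-t-start : ∀ m → P + m ≤ n → IsSurface s (suc P) (P + m) → T′ ≡ m
  surface-at-t-start m i≤n surf = ≤-antisym T′≤m m≤T′
    where
    open IsSurface surf
    m<T : m < T
    m<T = +-cancelˡ-< P m T (<-≤-trans (s≤s i≤n) (≤-reflexive (trans (sym N≡1+n) (sym P+T≡N))))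
    m≤T′ : m ≤ T′
    m≤T′ = mirrorOfSurface (≤⇒∃+ m<T)
      where
      mirrorOfSurface : ∃ (λ v → T ≡ suc m + v) → m ≤ T′
      mirrorOfSurface (v , T≡) = +-cancelˡ-≤ (P + suc v) m T′
        (≤-trans (≤-reflexive (sym N≡)) (subst (_≤ P + suc v + T′) Q′+T′≡N (+-monoˡ-≤ T′ Q′≤)))
        where
        N≡ : N ≡ P + suc v + m
        N≡ = trans (sym P+T≡N) (trans (cong (P +_) (trans T≡ (cong suc (+-comm m v)))) (sym (+-assoc P (suc v) m)))
        mirrored : Pal S (suc (P + suc v)) N
        mirrored = subst (Pal S (suc (P + suc v))) (sym N≡)
          (Pal-prefix⇒suffix S P m (suc v) (subst (Pal S (suc P)) (trans N≡ (trans (+-assoc P (suc v) m) (cong (P +_) (+-comm (suc v) m)))) t-pal)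
            (Pal-s⇒S i≤n palindrome))
        Q′≤ : Q′ ≤ P + suc v
        Q′≤ = ≮⇒≥ λ P+v<Q′ → t′-max (P + suc v) (m<m+n P (s≤s z≤n)) P+v<Q′ mirrored
    T′≤m : T′ ≤ m
    T′≤m = mirrorOfT′ (≤⇒∃+ (∸-monoʳ-≤ N (<⇒≤ T′<T)))
      where
      mirrorOfT′ : ∃ (λ u → Q′ ≡ P + u) → T′ ≤ m
      mirrorOfT′ (u , Q′≡) = +-cancelˡ-≤ P T′ m (≮⇒≥ λ i<P+T′ →
        rightMaximal (P + T′) i<P+T′ (<N⇒≤n P+T′<N) (Pal-S⇒s (<N⇒≤n P+T′<N) prefix))
        where
        N≡ : N ≡ P + (u + T′)
        N≡ = trans (sym Q′+T′≡N) (trans (cong (_+ T′) Q′≡) (+-assoc P u T′))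
        prefix : Pal S (suc P) (P + T′)
        prefix = Pal-suffix⇒prefix S P u T′ (subst (Pal S (suc P)) N≡ t-pal)
          (subst₂ (λ b e → Pal S (suc b) e) Q′≡ (trans N≡ (sym (+-assoc P u T′))) t′-pal)

  sufsurf-t-start : ∀ i → i ≤ n → i ∸ suflen s i ≡ P → IsSurface s (suc P) i
                    → i ≡ P + T′ × sufsurf s (P + T′) ≡ t′ × 1 ≤ length t′
  sufsurf-t-start i i≤n i∸K≡P surf with ≤⇒∃+ (≤-trans (n≤1+n P) (IsSurface.start≤end surf))
  ... | m , refl = cong (P +_) (sym T′≡m) , subst (λ e → sufsurf s (P + e) ≡ t′) (sym T′≡m) sufsurf≡ ,
                   subst (1 ≤_) (sym (trans length-t′ T′≡m)) 1≤m
    where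
    T′≡m : T′ ≡ m
    T′≡m = surface-at-t-start m i≤n surf
    1≤m : 1 ≤ m
    1≤m = +-cancelˡ-≤ P 1 m (subst (_≤ P + m) (+-comm 1 P) (IsSurface.start≤end surf))
    K = suflen s (P + m)
    sufsurf≡ : sufsurf s (P + m) ≡ t′
    sufsurf≡ = begin
      sufsurf s (P + m)                                  ≡⟨ sufsurf-surface s (P + m) (subst (λ b → IsSurface s b (P + m)) (sym start≡) surf) ⟩
      drop (length (take (P + m) s) ∸ K) (take (P + m) s) ≡⟨ cong (λ e → drop (e ∸ K) (take (P + m) s)) (length-take-≤ (P + m) s i≤n) ⟩
      drop (P + m ∸ K) (take (P + m) s)                   ≡⟨ cong (λ e → drop e (take (P + m) s)) i∸K≡P ⟩
      drop P (take (P + m) s)                             ≡⟨ take-drop m P s ⟨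
      take m (drop P s)                                   ≡⟨ take-drop-++ˡ P m s [ c ] i≤n ⟨
      take m (drop P S)                                   ≡⟨ cong (take m) t≡ ⟨
      take m t                                            ≡⟨ cong (λ e → take e t) T′≡m ⟨
      take T′ t                                           ≡⟨ take-t≡t′ ⟩
      t′                                                  ∎
      where
      open ≡-Reasoning
      start≡ : suc (P + m) ∸ K ≡ suc P
      start≡ = trans (sufStart s (P + m) i≤n) (cong suc i∸K≡P)

  sufsurf-q : sufsurf s (P + T′) ≡ t′ → 1 ≤ length t′ → sufsurf S (P + T′) ≡ []
  sufsurf-q sufsurf≡t′ 1≤t′ = sufsurf-¬surface S q λ surf →
    IsSurface.rightMaximal surf N P+T′<N ≤-refl (subst (λ b → Pal S b N) (sym start≡) t-pal)
    where
    q = P + T′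
    q≤n = <N⇒≤n P+T′<N
    surfs : IsSurface s (suc q ∸ suflen s q) q
    surfs = decidable-stable (IsSurface? s (suc q ∸ suflen s q) q) λ ¬surf →
      <-irrefl refl (<-≤-trans 1≤t′ (≤-reflexive (cong length (trans (sym sufsurf≡t′) (sufsurf-¬surface s q ¬surf)))))
    K≡T′ : suflen s q ≡ T′
    K≡T′ = begin
      suflen s q          ≡⟨ length-sufpal s q q≤n ⟨
      length (sufpal s q) ≡⟨ cong length (sufsurf-surface s q surfs) ⟨
      length (sufsurf s q) ≡⟨ cong length sufsurf≡t′ ⟩
      length t′           ≡⟨ length-t′ ⟩
      T′                  ∎
      where open ≡-Reasoning
    start≡ : suc q ∸ suflen S q ≡ suc P
    start≡ = trans (cong (suc q ∸_) (trans (suflen-S q q≤n) K≡T′)) (m+n∸n≡m (suc P) T′)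

  sufsurf-palToEnd : ∀ i → i ≤ n → ¬ (i ≡ P + T′ × sufsurf s (P + T′) ≡ t′ × 1 ≤ length t′)
                     → Pal S (suc (i ∸ suflen s i)) N → sufsurf S i ≡ sufsurf s i
  sufsurf-palToEnd i i≤n exception palN = trans (sufsurf-¬surface S i ¬surfS) (sym (sufsurf-¬surface s i ¬surfs))
    where
    ¬surfS : ¬ IsSurface S (suc i ∸ suflen S i) i
    ¬surfS surf = IsSurface.rightMaximal surf N (≤n⇒<N i≤n) ≤-refl (subst (λ b → Pal S b N) (sym (sufStart-S i i≤n)) palN)
    ¬surfs : ¬ IsSurface s (suc i ∸ suflen s i) i
    ¬surfs surf = [ strictly-inside , at-t-start ]′ (m≤n⇒m<n∨m≡n (t-start-least (i ∸ suflen s i) palN))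
      where
      surf′ : IsSurface s (suc (i ∸ suflen s i)) i
      surf′ = subst (λ b → IsSurface s b i) (sufStart s i i≤n) surf
      strictly-inside : P < i ∸ suflen s i → ⊥
      strictly-inside P<b = ¬LeftMaximal-s i≤n palN (s≤s P<b) (IsSurface.palindrome surf′) (IsSurface.leftMaximal surf′)
      at-t-start : P ≡ i ∸ suflen s i → ⊥
      at-t-start P≡b = exception (sufsurf-t-start i i≤n (sym P≡b) (subst (λ b → IsSurface s (suc b) i) (sym P≡b) surf′))

  sufsurf-¬palToEnd : ∀ i → i ≤ n → ¬ Pal S (suc (i ∸ suflen s i)) N → sufsurf S i ≡ sufsurf s i
  sufsurf-¬palToEnd i i≤n ¬palN = sym (sufsurf-≡ s S i (sym (sufpal-S i i≤n))
    (subst₂ (λ b b′ → IsSurface s b i ⇔ IsSurface S b′ i) (sym (sufStart s i i≤n)) (sym (sufStart-S i i≤n))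
      (IsSurface-snoc⇔ i≤n ¬palN)))

  sufsurf-elsewhere : ∀ i → i ≤ n → ¬ (i ≡ P + T′ × sufsurf s (P + T′) ≡ t′ × 1 ≤ length t′)
                      → sufsurf S i ≡ sufsurf s i
  sufsurf-elsewhere i i≤n exception =
    [ sufsurf-palToEnd i i≤n exception , sufsurf-¬palToEnd i i≤n ]′
      (toSum (Pal? S (i ∸ suflen s i) N (≤-trans (m∸n≤m i (suflen s i)) (≤n⇒≤N i≤n)) ≤-refl))

  T≡1⇒P+1≡N : T ≡ 1 → suc P ≡ N
  T≡1⇒P+1≡N T≡1 = trans (+-comm 1 P) (subst (λ e → P + e ≡ N) T≡1 P+T≡N)

  p≡P+1 : N ∸ length t + 1 ≡ suc P
  p≡P+1 = trans (cong (λ e → N ∸ e + 1) length-t) (+-comm P 1)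

  q≡P+T′ : N ∸ length t + length t′ ≡ P + T′
  q≡P+T′ = cong₂ (λ e e′ → N ∸ e + e′) length-t length-t′

  presurf-snoc : ∀ i → 1 ≤ i → i ≤ N →
    (i ≡ N ∸ length t + 1 → presurf S i ≡ t)
    × (i ≢ N ∸ length t + 1 → i ≡ N → length t ≢ 1 → presurf S i ≡ [])
    × (i ≢ N ∸ length t + 1 → ¬ (i ≡ N × length t ≢ 1) → presurf S i ≡ presurf s i)
  presurf-snoc (suc i₀) _ i≤N =
    (λ i≡p → subst (λ i → presurf S i ≡ t) (sym (trans i≡p p≡P+1)) presurf-t-start) ,
    (λ _ i≡N t≢1 → presurf-end i₀ i≡N (λ T≡1 → t≢1 (trans length-t T≡1))) ,
    λ i≢p ¬end → presurf-elsewhere i₀ (i≤n i≢p ¬end) (λ i≡P+1 → i≢p (trans i≡P+1 (sym p≡P+1)))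
    where
    i≤n : suc i₀ ≢ N ∸ length t + 1 → ¬ (suc i₀ ≡ N × length t ≢ 1) → suc i₀ ≤ n
    i≤n i≢p ¬end with m≤n⇒m<n∨m≡n i≤N | length t ≟ℕ 1
    ... | inj₁ i<N | _      = <N⇒≤n i<N
    ... | inj₂ i≡N | no t≢1 = ⊥-elim (¬end (i≡N , t≢1))
    ... | inj₂ i≡N | yes t≡1 = ⊥-elim (i≢p (trans i≡N (sym (trans p≡P+1 (T≡1⇒P+1≡N (trans (sym length-t) t≡1))))))

  sufsurf-snoc : ∀ i → 1 ≤ i → i ≤ N →
    (i ≡ N → sufsurf S i ≡ t)
    × (i ≢ N → i ≡ N ∸ length t + length t′ → sufsurf s (N ∸ length t + length t′) ≡ t′ → 1 ≤ length t′ → sufsurf S i ≡ [])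
    × (i ≢ N → ¬ (i ≡ N ∸ length t + length t′ × sufsurf s (N ∸ length t + length t′) ≡ t′ × 1 ≤ length t′)
       → sufsurf S i ≡ sufsurf s i)
  sufsurf-snoc i _ i≤N =
    (λ { refl → sufsurf-end }) ,
    (λ _ i≡q sufsurf≡t′ 1≤t′ → subst (λ e → sufsurf S e ≡ []) (sym (trans i≡q q≡P+T′))
       (sufsurf-q (subst (λ e → sufsurf s e ≡ t′) q≡P+T′ sufsurf≡t′) 1≤t′)) ,
    λ i≢N ¬exception → sufsurf-elsewhere i (<N⇒≤n (≤∧≢⇒< i≤N i≢N))
      (λ (i≡q , sufsurf≡t′ , 1≤t′) → ¬exception (trans i≡q (sym q≡P+T′) , subst (λ e → sufsurf s e ≡ t′) (sym q≡P+T′) sufsurf≡t′ , 1≤t′))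

lemma23 : {A : Set} (_≟_ : DecidableEquality A) (s : List A) (c : A) →
  let open Strings _≟_
      sc = s ++ [ c ]
      t = sufpal sc (length sc)
      t′ = longestProperPalSuffix t
      p = length sc ∸ length t + 1
      q = length sc ∸ length t + length t′
  in (∀ i → 1 ≤ i → i ≤ length sc →
        (i ≡ p → presurf sc i ≡ t)
        × (i ≢ p → i ≡ length sc → length t ≢ 1 → presurf sc i ≡ [])
        × (i ≢ p → ¬ (i ≡ length sc × length t ≢ 1) → presurf sc i ≡ presurf s i))
     × (∀ i → 1 ≤ i → i ≤ length sc →
        (i ≡ length sc → sufsurf sc i ≡ t)
        × (i ≢ length sc → i ≡ q → sufsurf s q ≡ t′ → 1 ≤ length t′ → sufsurf sc i ≡ [])
        × (i ≢ length sc → ¬ (i ≡ q × sufsurf s q ≡ t′ × 1 ≤ length t′)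
           → sufsurf sc i ≡ sufsurf s i))
lemma23 _≟_ s c = Snoc.presurf-snoc _≟_ s c , Snoc.sufsurf-snoc _≟_ s c
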